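{- Let $s\in\{\mathtt{0},\mathtt{1}\}^{\mathbb{Z}}$ be a balanced sequence having at least one factorization $s=\widetilde{p}xyp$ with $\{x,y\}=\{\mathtt{0},\mathtt{1}\}$, where $p$ is a right-infinite word. Let $n\ge1$ and let $u_0,\dots,u_n$ be the $n+1$ factors of length $n$ of $s$, ordered so that $u_0<_{lex}\cdots<_{lex}u_n$. Let $w$ be the prefix of length $n-1$ of $p$. Then: (i) $u_0=\mathtt{0}w$ and $u_n=\mathtt{1}w$; (ii) there exists $i\in\{0,\dots,n-1\}$ such that $u_i=\widetilde{w}\mathtt{0}$ and $u_{i+1}=\widetilde{w}\mathtt{1}$; (iii) for all $j\in\{0,\dots,n-1\}\setminus\{i\}$ there exist prefixes $x,y$ of $w$ such that $u_j=\widetilde{x}\mathtt{0}\mathtt{1}y$ and $u_{j+1}=\widetilde{x}\mathtt{1}\mathtt{0}y$.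
   Context: $s$ is balanced if for every $n\ge1$, any two factors of $s$ of length $n$ have numbers of occurrences of each letter differing by at most 1. The reversal of a finite word $w_1\cdots w_n$ is $w_n\cdots w_1$; the reversal $\widetilde{p}$ of a right-infinite word $p=p_0p_1\cdots$ is the left-infinite word $\cdots p_1p_0$. $<_{lex}$ is the lexicographic order with $\mathtt{0}<\mathtt{1}$. -}

module Defs where

open import Data.Bool using (Bool; true; false)
open import Data.Nat using (ℕ; zero; suc; _+_; _≤_)
open import Data.Integer as ℤ using (ℤ)
open import Data.List using (List; []; _∷_)
open import Data.Product using (∃)
open import Relation.Binary.PropositionalEquality using (_≡_; _≢_)

-- Letters: false = 0, true = 1.  A bi-infinite binary sequence is ℤ → Bool.

window : (ℤ → Bool) → ℤ → ℕ → List Bool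
window s k zero = []
window s k (suc n) = s k ∷ window s (k ℤ.+ ℤ.+ 1) n

IsFactor : (ℤ → Bool) → List Bool → Set
IsFactor s u = ∃ λ k → window s k (Data.List.length u) ≡ u

count : Bool → List Bool → ℕ
count b [] = zero
count false (false ∷ u) = suc (count false u)
count false (true ∷ u) = count false u
count true (true ∷ u) = suc (count true u)
count true (false ∷ u) = count true u

-- balanced: for n ≥ 1, factors of equal length n have letter counts
-- differing by at most 1 (stated one-sidedly for all ordered pairs)
Balanced : (ℤ → Bool) → Set
Balanced s = ∀ (n : ℕ) → 1 ≤ n → ∀ u v → Data.List.length u ≡ n → Data.List.length v ≡ n →
  IsFactor s u → IsFactor s v → ∀ b → count b u ≤ count b v + 1

-- lexicographic order (0 < 1) on words (used on words of equal length)
data _<lex_ : List Bool → List Bool → Set where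
  here : ∀ {u v} → (false ∷ u) <lex (true ∷ v)
  there : ∀ {b u v} → u <lex v → (b ∷ u) <lex (b ∷ v)

-- s = p̃ x y p, with x at position k, y at position k+1, x ≠ y
Factorization : (ℤ → Bool) → ℤ → (ℕ → Bool) → Set
Factorization s k p =
  (s k ≢ s (k ℤ.+ ℤ.+ 1)) Data.Product.×
  (∀ (m : ℕ) → s (k ℤ.- ℤ.+ (suc m)) ≡ p m) Data.Product.×
  (∀ (m : ℕ) → s (k ℤ.+ ℤ.+ (2 + m)) ≡ p m)

pref : (ℕ → Bool) → ℕ → List Bool
pref p zero = []
pref p (suc m) = p zero ∷ pref (λ i → p (suc i)) m

{-# OPTIONS --safe #-}
-- Call a word a factor up to reversal if it or its reversal is a factor of s.  Balance
-- forbids 0q0 and 1q1 from both being such words, so for each length at most one v has 0v and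
-- 1v both factors up to reversal; as b·p[0..m) is one for each letter b (read off s = p̃xyp),
-- that v is p[0..|v|).  Hence there are at most n + 1 factors up to reversal of length n,
-- while the n + 1 windows of length n meeting the centre xy are pairwise distinct: these
-- windows are all of them, and the factors of s are closed under reversal.
-- In the sorted list 0w and 1w are extreme (a factor beyond them yields 0q0 and 1q1), w̃0 and
-- w̃1 are neighbours, and for any other neighbours z0α < z1β the word z is right special,
-- hence z = p̃[0..|z|).  Then α = 1·p[..] and β = 0·p[..]: otherwise either the factor
-- z01·p[..] or z10·p[..] lies strictly between the neighbours, or at the first disagreement,
-- position i, some z01q or z10q with |q| = i is right special, i.e. a reversed prefix of p,
-- which gives p a different letter at i.

module Submission where

open import Defs
open import Data.Bool as Bool using (Bool; true; false; not)
import Data.Bool.Properties as Boolₚ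
open import Data.Nat as ℕ using (ℕ; zero; suc; _+_; _≤_; _<_; _∸_; z≤n; s≤s)
import Data.Nat.Properties as ℕₚ
open import Data.Integer as ℤ using (ℤ)
import Data.Integer.Properties as ℤₚ
open import Data.Integer.Tactic.RingSolver using (solve-∀)
open import Data.Fin as F using (Fin; inject₁; fromℕ; toℕ; cast)
import Data.Fin.Properties as Finₚ
open import Data.Fin.Induction using (<-weakInduction)
open import Data.List
  using (List; []; _∷_; _++_; length; reverse; take; drop; map; filter; lookup; applyUpTo)
import Data.List.Properties as Listₚ
open import Data.List.Relation.Unary.All as All using (All; []; _∷_)
import Data.List.Relation.Unary.All.Properties as Allₚ
open import Data.List.Relation.Unary.Any using (index)
import Data.List.Relation.Unary.Any.Properties as Anyₚ
open import Data.List.Relation.Unary.AllPairs using ([]; _∷_)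
import Data.List.Relation.Unary.AllPairs.Properties as AllPairsₚ
open import Data.List.Relation.Unary.Linked using (Linked; []; [-]; _∷_)
open import Data.List.Relation.Unary.Unique.Propositional using (Unique)
import Data.List.Relation.Unary.Unique.Propositional.Properties as Uniqueₚ
open import Data.List.Relation.Binary.Lex.Core using (Lex-≤; base; halt; this; next)
open import Data.List.Relation.Binary.Lex.Strict using (≤-decTotalOrder)
open import Data.List.Relation.Binary.Permutation.Propositional using (_↭_; ↭-sym; ↭⇒↭ₛ)
open import Data.List.Relation.Binary.Permutation.Propositional.Properties
  using (All-resp-↭; ∈-resp-↭; ↭-length)
import Data.List.Relation.Binary.Permutation.Setoid.Properties as Permₛ
open import Data.List.Membership.Propositional using (_∈_)
open import Data.List.Membership.Propositional.Properties using (∈-lookup)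
open import Data.Product as Product using (Σ; ∃; _×_; _,_; proj₁; proj₂)
open import Data.Sum as Sum using (_⊎_; inj₁; inj₂)
open import Data.Empty using (⊥; ⊥-elim)
open import Function using (_∘_)
open import Relation.Nullary using (¬_; yes; no; ¬?)
open import Relation.Binary.Definitions using (DecidableEquality; tri<; tri≈; tri>)
open import Relation.Binary.PropositionalEquality

_≟ᵂ_ : DecidableEquality (List Bool)
_≟ᵂ_ = Listₚ.≡-dec Bool._≟_

open import Data.List.Membership.DecPropositional _≟ᵂ_ using (_∈?_)
open import Data.List.Sort (≤-decTotalOrder Boolₚ.<-strictTotalOrder) using (sort; sort-↭; sort-↗)

<lex-trans : ∀ {u v w} → u <lex v → v <lex w → u <lex w
<lex-trans here      (there _) = here
<lex-trans (there _) here      = here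
<lex-trans (there h) (there g) = there (<lex-trans h g)

<lex-irrefl : ∀ {u} → ¬ u <lex u
<lex-irrefl (there h) = <lex-irrefl h

<lex-asym : ∀ {u v} → u <lex v → ¬ v <lex u
<lex-asym h g = <lex-irrefl (<lex-trans h g)

<lex-compare : ∀ u v → length u ≡ length v → u ≡ v ⊎ u <lex v ⊎ v <lex u
<lex-compare []          []          _ = inj₁ refl
<lex-compare (false ∷ u) (true ∷ v)  _ = inj₂ (inj₁ here)
<lex-compare (true ∷ u)  (false ∷ v) _ = inj₂ (inj₂ here)
<lex-compare (false ∷ u) (false ∷ v) l =
  Sum.map (cong (false ∷_)) (Sum.map there there) (<lex-compare u v (ℕₚ.suc-injective l))
<lex-compare (true ∷ u)  (true ∷ v)  l =
  Sum.map (cong (true ∷_)) (Sum.map there there) (<lex-compare u v (ℕₚ.suc-injective l))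

<lex-split : ∀ {u v} → u <lex v →
             ∃ λ z → ∃ λ α → ∃ λ β → u ≡ z ++ false ∷ α × v ≡ z ++ true ∷ β
<lex-split (here {u} {v}) = [] , u , v , refl , refl
<lex-split (there {b} h) with <lex-split h
... | z , α , β , refl , refl = b ∷ z , α , β , refl , refl

<lex-fork : ∀ z {α β} → (z ++ false ∷ α) <lex (z ++ true ∷ β)
<lex-fork []      = here
<lex-fork (_ ∷ z) = there (<lex-fork z)

<lex-++⁺ˡ : ∀ z {x y} → x <lex y → (z ++ x) <lex (z ++ y)
<lex-++⁺ˡ []      h = h
<lex-++⁺ˡ (_ ∷ z) h = there (<lex-++⁺ˡ z h)

<lex-no-word-between : ∀ z x → (z ++ false ∷ []) <lex x → x <lex (z ++ true ∷ []) → ⊥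
<lex-no-word-between []          (true ∷ x)  here      (there ())
<lex-no-word-between []          (false ∷ x) (there ()) _
<lex-no-word-between (false ∷ z) (true ∷ x)  here      ()
<lex-no-word-between (a ∷ z)     (.a ∷ x)    (there h) (there g) = <lex-no-word-between z x h g

Lex-≤⇒<lex : ∀ {u v} → length u ≡ length v → u ≢ v → Lex-≤ _≡_ Bool._<_ u v → u <lex v
Lex-≤⇒<lex _ u≢v (base _)        = ⊥-elim (u≢v refl)
Lex-≤⇒<lex () _ halt
Lex-≤⇒<lex _ _   (this Bool.f<t) = here
Lex-≤⇒<lex l u≢v (next refl h)   = there (Lex-≤⇒<lex (ℕₚ.suc-injective l) (u≢v ∘ cong (_ ∷_)) h)

Linked-Lex-≤⇒Linked-<lex : ∀ {n xs} → Linked (Lex-≤ _≡_ Bool._<_) xs → Unique xs →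
                           All (λ v → length v ≡ n) xs → Linked _<lex_ xs
Linked-Lex-≤⇒Linked-<lex []       _            _              = []
Linked-Lex-≤⇒Linked-<lex [-]      _            _              = [-]
Linked-Lex-≤⇒Linked-<lex (r ∷ rs) (x∉xs ∷ xs!) (l ∷ l′ ∷ ls) =
  Lex-≤⇒<lex (trans l (sym l′)) (All.head x∉xs) r ∷ Linked-Lex-≤⇒Linked-<lex rs xs! (l′ ∷ ls)

module _ {A B : Set} where

  Unique-map⁺-injectiveOn : ∀ {P : A → Set} {f : A → B} →
    (∀ {x y} → P x → P y → f x ≡ f y → x ≡ y) →
    ∀ {xs} → All P xs → Unique xs → Unique (map f xs)
  Unique-map⁺-injectiveOn f-inj {[]}     []         []           = []
  Unique-map⁺-injectiveOn f-inj {x ∷ xs} (px ∷ pxs) (x∉xs ∷ xs!) =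
    Allₚ.map⁺ (All.zipWith (λ (py , x≢y) → x≢y ∘ f-inj px py) (pxs , x∉xs))
    ∷ Unique-map⁺-injectiveOn f-inj pxs xs!

module _ {A : Set} where

  ++-injective : ∀ {w x y z : List A} → length w ≡ length x → w ++ y ≡ x ++ z → w ≡ x × y ≡ z
  ++-injective {[]}    {[]}    _ e = refl , e
  ++-injective {_ ∷ w} {_ ∷ x} l e with Listₚ.∷-injective e
  ... | refl , e′ = Product.map₁ (cong (_ ∷_)) (++-injective (ℕₚ.suc-injective l) e′)

  length≤1+length-filter-≢ : ∀ (_≟_ : DecidableEquality A) e {xs} → Unique xs →
    length xs ≤ suc (length (filter (λ x → ¬? (x ≟ e)) xs))
  length≤1+length-filter-≢ _≟_ e {[]}     []           = z≤n
  length≤1+length-filter-≢ _≟_ e {x ∷ xs} (x∉xs ∷ xs!) with x ≟ e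
  ... | yes refl = s≤s (ℕₚ.≤-reflexive (cong length (sym
                     (Listₚ.filter-all (λ y → ¬? (y ≟ e)) (All.map (_∘ sym) x∉xs)))))
  ... | no _     = s≤s (length≤1+length-filter-≢ _≟_ e xs!)

  reverse-∷-reverse : ∀ (b : A) x → reverse (b ∷ reverse x) ≡ x ++ b ∷ []
  reverse-∷-reverse b x =
    trans (Listₚ.unfold-reverse b (reverse x)) (cong (_++ b ∷ []) (Listₚ.reverse-involutive x))

  reverse-reverse-∷ʳ : ∀ (b : A) x → reverse (reverse x ++ b ∷ []) ≡ b ∷ x
  reverse-reverse-∷ʳ b x =
    trans (Listₚ.reverse-++ (reverse x) (b ∷ [])) (cong (b ∷_) (Listₚ.reverse-involutive x))

  reverse-centre : ∀ (x y : List A) a b → reverse (reverse x ++ a ∷ b ∷ y) ≡ reverse y ++ b ∷ a ∷ x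
  reverse-centre x y a b = begin
    reverse (reverse x ++ a ∷ b ∷ y)              ≡⟨ Listₚ.reverse-++ (reverse x) (a ∷ b ∷ y) ⟩
    reverse (a ∷ b ∷ y) ++ reverse (reverse x)    ≡⟨ cong₂ _++_ (Listₚ.reverse-++ (a ∷ b ∷ []) y)
                                                                (Listₚ.reverse-involutive x) ⟩
    (reverse y ++ b ∷ a ∷ []) ++ x                ≡⟨ Listₚ.++-assoc (reverse y) (b ∷ a ∷ []) x ⟩
    reverse y ++ b ∷ a ∷ x                        ∎
    where open ≡-Reasoning

  length-++-cong : ∀ (z : List A) {x y} → length x ≡ length y → length (z ++ x) ≡ length (z ++ y)
  length-++-cong z {x} {y} l = trans (Listₚ.length-++ z) (trans (cong (length z +_) l) (sym (Listₚ.length-++ z)))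

  lookup-Linked : ∀ {R : A → A → Set} {n} {xs} → Linked R xs → (eq : suc n ≡ length xs) →
    ∀ (j : Fin n) → R (lookup xs (cast eq (inject₁ j))) (lookup xs (cast eq (F.suc j)))
  lookup-Linked (r ∷ _)  eq F.zero    = r
  lookup-Linked (_ ∷ rs) eq (F.suc j) = lookup-Linked rs (ℕₚ.suc-injective eq) j

count-++ : ∀ b x y → count b (x ++ y) ≡ count b x + count b y
count-++ b     []          y = refl
count-++ false (false ∷ x) y = cong suc (count-++ false x y)
count-++ false (true ∷ x)  y = count-++ false x y
count-++ true  (true ∷ x)  y = cong suc (count-++ true x y)
count-++ true  (false ∷ x) y = count-++ true x y

count-reverse : ∀ b x → count b (reverse x) ≡ count b x
count-reverse b []      = refl
count-reverse b (a ∷ x) = begin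
  count b (reverse (a ∷ x))           ≡⟨ cong (count b) (Listₚ.unfold-reverse a x) ⟩
  count b (reverse x ++ a ∷ [])        ≡⟨ count-++ b (reverse x) (a ∷ []) ⟩
  count b (reverse x) + count b (a ∷ []) ≡⟨ cong (_+ count b (a ∷ [])) (count-reverse b x) ⟩
  count b x + count b (a ∷ [])          ≡⟨ ℕₚ.+-comm (count b x) _ ⟩
  count b (a ∷ []) + count b x          ≡⟨ count-++ b (a ∷ []) x ⟨
  count b (a ∷ x)                      ∎
  where open ≡-Reasoning

length-pref : ∀ p m → length (pref p m) ≡ m
length-pref p zero    = refl
length-pref p (suc m) = cong suc (length-pref (p ∘ suc) m)

pref-suc : ∀ p m → pref p (suc m) ≡ pref p m ++ p m ∷ []
pref-suc p zero    = refl
pref-suc p (suc m) = cong (p zero ∷_) (pref-suc (p ∘ suc) m)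

pref-lookup : ∀ p m x {a r} → pref p m ≡ x ++ a ∷ r → p (length x) ≡ a
pref-lookup p (suc m) []      e = Listₚ.∷-injectiveˡ e
pref-lookup p (suc m) (_ ∷ x) e = pref-lookup (p ∘ suc) m x (Listₚ.∷-injectiveʳ e)

take-pref : ∀ p {a m} → a ≤ m → take a (pref p m) ≡ pref p a
take-pref p z≤n                 = refl
take-pref p (s≤s a≤m) = cong (p zero ∷_) (take-pref (p ∘ suc) a≤m)

module _ (s : ℤ → Bool) where

  length-window : ∀ i m → length (window s i m) ≡ m
  length-window i zero    = refl
  length-window i (suc m) = cong suc (length-window _ m)

  window-IsFactor : ∀ i m → IsFactor s (window s i m)
  window-IsFactor i m = i , cong (window s i) (length-window i m)

  window-+ : ∀ i m n → window s i (m + n) ≡ window s i m ++ window s (i ℤ.+ ℤ.+ m) n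
  window-+ i zero    n = cong (λ j → window s j n) (sym (ℤₚ.+-identityʳ i))
  window-+ i (suc m) n = cong (s i ∷_) (trans (window-+ (i ℤ.+ ℤ.+ 1) m n)
    (cong (λ j → window s (i ℤ.+ ℤ.+ 1) m ++ window s j n) (ℤₚ.+-assoc i (ℤ.+ 1) (ℤ.+ m))))

  window-≡-at : ∀ {i i′ n} → window s i n ≡ window s i′ n →
                ∀ {t} → t < n → s (i ℤ.+ ℤ.+ t) ≡ s (i′ ℤ.+ ℤ.+ t)
  window-≡-at {i} {i′} e {zero} (s≤s _) =
    trans (cong s (ℤₚ.+-identityʳ i))
      (trans (Listₚ.∷-injectiveˡ e) (cong s (sym (ℤₚ.+-identityʳ i′))))
  window-≡-at {i} {i′} e {suc t} (s≤s t<n) =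
    trans (cong s (sym (ℤₚ.+-assoc i (ℤ.+ 1) (ℤ.+ t))))
      (trans (window-≡-at (Listₚ.∷-injectiveʳ e) t<n) (cong s (ℤₚ.+-assoc i′ (ℤ.+ 1) (ℤ.+ t))))

  IsFactor-++ : ∀ x y → IsFactor s (x ++ y) → IsFactor s x × IsFactor s y
  IsFactor-++ x y (i , e) with ++-injective (length-window i (length x)) split
    where
      split : window s i (length x) ++ window s (i ℤ.+ ℤ.+ length x) (length y) ≡ x ++ y
      split = trans (sym (window-+ i (length x) (length y)))
                    (trans (cong (window s i) (sym (Listₚ.length-++ x))) e)
  ... | ex , ey = (i , ex) , (_ , ey)

  IsFactor-prefix-∷ʳ : ∀ x b {r} → IsFactor s (x ++ b ∷ r) → IsFactor s (x ++ b ∷ [])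
  IsFactor-prefix-∷ʳ x b {r} f =
    proj₁ (IsFactor-++ (x ++ b ∷ []) r (subst (IsFactor s) (sym (Listₚ.++-assoc x (b ∷ []) r)) f))

  window≡pref : ∀ i q → (∀ m → s (i ℤ.+ ℤ.+ m) ≡ q m) → ∀ m → window s i m ≡ pref q m
  window≡pref i q h zero    = refl
  window≡pref i q h (suc m) = cong₂ _∷_ (trans (cong s (sym (ℤₚ.+-identityʳ i))) (h 0))
    (window≡pref (i ℤ.+ ℤ.+ 1) (q ∘ suc)
      (λ t → trans (cong s (ℤₚ.+-assoc i (ℤ.+ 1) (ℤ.+ t))) (h (suc t))) m)

  window≡reverse-pref : ∀ j q → (∀ m → s (j ℤ.- ℤ.+ suc m) ≡ q m) →
                        ∀ m → window s (j ℤ.- ℤ.+ m) m ≡ reverse (pref q m)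
  window≡reverse-pref j q h zero    = refl
  window≡reverse-pref j q h (suc m) = begin
    s (j ℤ.- ℤ.+ suc m) ∷ window s ((j ℤ.- ℤ.+ suc m) ℤ.+ ℤ.+ 1) m
      ≡⟨ cong₂ _∷_ (h m) (cong (λ i → window s i m) (step j (ℤ.+ m))) ⟩
    q m ∷ window s (j ℤ.- ℤ.+ m) m   ≡⟨ cong (q m ∷_) (window≡reverse-pref j q h m) ⟩
    q m ∷ reverse (pref q m)          ≡⟨ Listₚ.reverse-++ (pref q m) (q m ∷ []) ⟨
    reverse (pref q m ++ q m ∷ [])     ≡⟨ cong reverse (pref-suc q m) ⟨
    reverse (pref q (suc m))          ∎
    where
      open ≡-Reasoning
      step : ∀ j x → (j ℤ.- (ℤ.+ 1 ℤ.+ x)) ℤ.+ ℤ.+ 1 ≡ j ℤ.- x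
      step = solve-∀

-- Balance

FactorUpToReversal : (ℤ → Bool) → List Bool → Set
FactorUpToReversal s v = IsFactor s v ⊎ IsFactor s (reverse v)

module _ {s : ℤ → Bool} where

  FactorUpToReversal-++ : ∀ x y → FactorUpToReversal s (x ++ y) →
                          FactorUpToReversal s x × FactorUpToReversal s y
  FactorUpToReversal-++ x y (inj₁ f) = Product.map inj₁ inj₁ (IsFactor-++ s x y f)
  FactorUpToReversal-++ x y (inj₂ f)
    with IsFactor-++ s (reverse y) (reverse x) (subst (IsFactor s) (Listₚ.reverse-++ x y) f)
  ... | fy , fx = inj₂ fx , inj₂ fy

  FactorUpToReversal-prefix-∷ʳ : ∀ x b {r} → FactorUpToReversal s (x ++ b ∷ r) →
                                FactorUpToReversal s (x ++ b ∷ [])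
  FactorUpToReversal-prefix-∷ʳ x b {r} f = proj₁ (FactorUpToReversal-++ (x ++ b ∷ []) r
    (subst (FactorUpToReversal s) (sym (Listₚ.++-assoc x (b ∷ []) r)) f))

  FactorUpToReversal⇒IsFactor-with-same-counts : ∀ {u} → FactorUpToReversal s u →
    ∃ λ u′ → IsFactor s u′ × length u′ ≡ length u × (∀ b → count b u′ ≡ count b u)
  FactorUpToReversal⇒IsFactor-with-same-counts {u} (inj₁ f) = u , f , refl , λ _ → refl
  FactorUpToReversal⇒IsFactor-with-same-counts {u} (inj₂ f) =
    reverse u , f , Listₚ.length-reverse u , λ b → count-reverse b u

module _ {s : ℤ → Bool} (bal : Balanced s) where

  FactorUpToReversal-balanced : ∀ {u v} → FactorUpToReversal s u → FactorUpToReversal s v →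
    length u ≡ length v → 1 ≤ length u → ∀ b → count b u ≤ count b v + 1
  FactorUpToReversal-balanced fu fv l 1≤|u| b
    with FactorUpToReversal⇒IsFactor-with-same-counts fu | FactorUpToReversal⇒IsFactor-with-same-counts fv
  ... | u′ , fu′ , lu , cu | v′ , fv′ , lv , cv
    rewrite sym (cu b) | sym (cv b) =
      bal (length u′) (subst (1 ≤_) (sym lu) 1≤|u|) u′ v′ refl
          (trans lv (trans (sym l) (sym lu))) fu′ fv′ b

  0x∧1y⇒x≮y : ∀ {x y} → FactorUpToReversal s (false ∷ x) → FactorUpToReversal s (true ∷ y) →
              ¬ x <lex y
  0x∧1y⇒x≮y f₀ f₁ x<y with <lex-split x<y
  ... | q , α , β , refl , refl = ℕₚ.n≮n (suc c)
    (subst₂ _≤_ count-1q1 (trans (cong (_+ 1) count-0q0) (ℕₚ.+-comm c 1))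
      (FactorUpToReversal-balanced 1q1 0q0 (cong suc (length-++-cong q refl)) (s≤s z≤n) true))
    where
      c = count true q
      0q0 = FactorUpToReversal-prefix-∷ʳ (false ∷ q) false f₀
      1q1 = FactorUpToReversal-prefix-∷ʳ (true ∷ q) true f₁
      count-1q1 : count true (true ∷ q ++ true ∷ []) ≡ suc (suc c)
      count-1q1 = cong suc (trans (count-++ true q (true ∷ [])) (ℕₚ.+-comm c 1))
      count-0q0 : count true (false ∷ q ++ false ∷ []) ≡ c
      count-0q0 = trans (count-++ true q (false ∷ [])) (ℕₚ.+-identityʳ c)

  left-special-unique : ∀ {v t} → length v ≡ length t →
    FactorUpToReversal s (false ∷ v) → FactorUpToReversal s (true ∷ v) →
    FactorUpToReversal s (false ∷ t) → FactorUpToReversal s (true ∷ t) → v ≡ t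
  left-special-unique {v} {t} l f₀v f₁v f₀t f₁t with <lex-compare v t l
  ... | inj₁ v≡t        = v≡t
  ... | inj₂ (inj₁ v<t) = ⊥-elim (0x∧1y⇒x≮y f₀v f₁t v<t)
  ... | inj₂ (inj₂ t<v) = ⊥-elim (0x∧1y⇒x≮y f₀t f₁v t<v)

-- Lexicographic enumerations

module Enumeration {n} (F : List Bool → Set) (u : Fin (suc n) → List Bool)
                   (u-length : ∀ a → length (u a) ≡ n)
                   (u-increasing : ∀ (j : Fin n) → u (inject₁ j) <lex u (F.suc j))
                   (u-complete : ∀ v → length v ≡ n → F v → ∃ λ a → u a ≡ v) where

  compare : ∀ a b → u a ≡ u b ⊎ u a <lex u b ⊎ u b <lex u a
  compare a b = <lex-compare (u a) (u b) (trans (u-length a) (sym (u-length b)))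

  monotone : ∀ {a b} → a F.< b → u a <lex u b
  monotone {a} {b} = <-weakInduction (λ b → a F.< b → u a <lex u b) (λ ()) step b
    where
      step : ∀ i → (a F.< inject₁ i → u a <lex u (inject₁ i)) → a F.< F.suc i → u a <lex u (F.suc i)
      step i ih (s≤s a≤i) with a Finₚ.≟ inject₁ i
      ... | yes refl = u-increasing i
      ... | no  a≢i  = <lex-trans
        (ih (Finₚ.≤∧≢⇒< (subst (toℕ a ≤_) (sym (Finₚ.toℕ-inject₁ i)) a≤i) a≢i))
        (u-increasing i)

  reflect : ∀ {a b} → u a <lex u b → a F.< b
  reflect {a} {b} h with Finₚ.<-cmp a b
  ... | tri< a<b _ _ = a<b
  ... | tri≈ _ refl _ = ⊥-elim (<lex-irrefl h)
  ... | tri> _ _ b<a = ⊥-elim (<lex-asym h (monotone b<a))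

  injective : ∀ {a b} → u a ≡ u b → a ≡ b
  injective {a} {b} e with Finₚ.<-cmp a b
  ... | tri< a<b _ _ = ⊥-elim (<lex-irrefl (subst (u a <lex_) (sym e) (monotone a<b)))
  ... | tri≈ _ a≡b _ = a≡b
  ... | tri> _ _ b<a = ⊥-elim (<lex-irrefl (subst (u b <lex_) e (monotone b<a)))

  no-word-between : ∀ j v → length v ≡ n → F v → u (inject₁ j) <lex v → v <lex u (F.suc j) → ⊥
  no-word-between j v l f lo hi with u-complete v l f
  ... | a , refl = ℕₚ.<-irrefl refl (ℕₚ.<-≤-trans
        (subst (ℕ._< toℕ a) (Finₚ.toℕ-inject₁ j) (reflect lo)) (ℕₚ.≤-pred (reflect hi)))

  first : ∀ {v} → length v ≡ n → F v → (∀ a → ¬ u a <lex v) → u F.zero ≡ v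
  first l f minimal with u-complete _ l f
  ... | a , refl with compare F.zero a
  ...   | inj₁ e        = e
  ...   | inj₂ (inj₁ h) = ⊥-elim (minimal F.zero h)
  ...   | inj₂ (inj₂ h) with () ← reflect h

  last : ∀ {v} → length v ≡ n → F v → (∀ a → ¬ v <lex u a) → u (fromℕ n) ≡ v
  last l f maximal with u-complete _ l f
  ... | a , refl with compare (fromℕ n) a
  ...   | inj₁ e        = e
  ...   | inj₂ (inj₁ h) = ⊥-elim (ℕₚ.<⇒≱ (reflect h) (Finₚ.≤fromℕ a))
  ...   | inj₂ (inj₂ h) = ⊥-elim (maximal (fromℕ n) h)

  successor : ∀ {x y} → length x ≡ n → F x → length y ≡ n → F y → x <lex y →
              (∀ v → x <lex v → v <lex y → ⊥) →
              Σ (Fin n) λ i → u (inject₁ i) ≡ x × u (F.suc i) ≡ y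
  successor lx fx ly fy x<y gap with u-complete _ lx fx | u-complete _ ly fy
  ... | a , refl | b , refl = i , u-i≡x , u-1+i≡y
    where
      a<b : a F.< b
      a<b = reflect x<y
      n≢a : n ≢ toℕ a
      n≢a n≡a = ℕₚ.<⇒≱ (subst (ℕ._< toℕ b) (sym n≡a) a<b) (Finₚ.toℕ≤pred[n] b)
      i : Fin n
      i = F.lower₁ a n≢a
      u-i≡x : u (inject₁ i) ≡ u a
      u-i≡x = cong u (Finₚ.inject₁-lower₁ a n≢a)
      u-1+i≡y : u (F.suc i) ≡ u b
      u-1+i≡y with compare (F.suc i) b
      ... | inj₁ e        = e
      ... | inj₂ (inj₁ h) = ⊥-elim (gap _ (subst (_<lex u (F.suc i)) u-i≡x (u-increasing i)) h)
      ... | inj₂ (inj₂ h) = ⊥-elim (ℕₚ.<⇒≱ a<b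
            (subst (toℕ b ≤_) (Finₚ.toℕ-lower₁ a n≢a) (ℕₚ.≤-pred (reflect h))))

-- Balanced sequences with a factorisation p̃xyp

module WithFactorization {s : ℤ → Bool} (bal : Balanced s) {k : ℤ} {p : ℕ → Bool}
                         (fac : Factorization s k p) where

  private
    c≢c′ : s k ≢ s (k ℤ.+ ℤ.+ 1)
    c≢c′ = proj₁ fac

    left : ∀ m → s (k ℤ.- ℤ.+ suc m) ≡ p m
    left = proj₁ (proj₂ fac)

    right : ∀ m → s (k ℤ.+ ℤ.+ (2 + m)) ≡ p m
    right = proj₂ (proj₂ fac)

    c′≡¬c : s (k ℤ.+ ℤ.+ 1) ≡ not (s k)
    c′≡¬c = Boolₚ.¬-not (c≢c′ ∘ sym)

  window-centre : ∀ a b → window s (k ℤ.- ℤ.+ a) (a + (2 + b)) ≡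
                          reverse (pref p a) ++ s k ∷ s (k ℤ.+ ℤ.+ 1) ∷ pref p b
  window-centre a b = begin
    window s (k ℤ.- ℤ.+ a) (a + (2 + b))
      ≡⟨ window-+ s _ a (2 + b) ⟩
    window s (k ℤ.- ℤ.+ a) a ++ window s ((k ℤ.- ℤ.+ a) ℤ.+ ℤ.+ a) (2 + b)
      ≡⟨ cong₂ _++_ (window≡reverse-pref s k p left a)
                    (cong (λ i → window s i (2 + b)) (cancel k (ℤ.+ a))) ⟩
    reverse (pref p a) ++ s k ∷ s (k ℤ.+ ℤ.+ 1) ∷ window s ((k ℤ.+ ℤ.+ 1) ℤ.+ ℤ.+ 1) b
      ≡⟨ cong (λ w → reverse (pref p a) ++ s k ∷ s (k ℤ.+ ℤ.+ 1) ∷ w) (window≡pref s _ p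
           (λ m → trans (cong s (shift k (ℤ.+ m))) (right m)) b) ⟩
    reverse (pref p a) ++ s k ∷ s (k ℤ.+ ℤ.+ 1) ∷ pref p b ∎
    where
      open ≡-Reasoning
      cancel : ∀ k x → (k ℤ.- x) ℤ.+ x ≡ k
      cancel = solve-∀
      shift : ∀ k x → ((k ℤ.+ ℤ.+ 1) ℤ.+ ℤ.+ 1) ℤ.+ x ≡ k ℤ.+ (ℤ.+ 2 ℤ.+ x)
      shift = solve-∀

  IsFactor-centre : ∀ a b → IsFactor s (reverse (pref p a) ++ s k ∷ s (k ℤ.+ ℤ.+ 1) ∷ pref p b)
  IsFactor-centre a b = subst (IsFactor s) (window-centre a b) (window-IsFactor s _ _)

  ∷pref-FactorUpToReversal : ∀ m b → FactorUpToReversal s (b ∷ pref p m)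
  ∷pref-FactorUpToReversal m b with b Bool.≟ s k
  ... | yes refl = inj₂ (subst (IsFactor s) (sym (Listₚ.unfold-reverse b (pref p m)))
                     (IsFactor-prefix-∷ʳ s (reverse (pref p m)) b (IsFactor-centre m 0)))
  ... | no b≢c   = inj₁ (subst (λ b′ → IsFactor s (b′ ∷ pref p m))
                     (trans c′≡¬c (sym (Boolₚ.¬-not b≢c)))
                     (proj₂ (IsFactor-++ s (s k ∷ []) _ (IsFactor-centre 0 m))))

  left-special⇒pref : ∀ {v} → FactorUpToReversal s (false ∷ v) → FactorUpToReversal s (true ∷ v) →
                      v ≡ pref p (length v)
  left-special⇒pref f₀ f₁ = left-special-unique bal (sym (length-pref p _)) f₀ f₁
                              (∷pref-FactorUpToReversal _ false) (∷pref-FactorUpToReversal _ true)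

  centre-not-repeated : ∀ d → s (k ℤ.+ ℤ.+ 1 ℤ.+ ℤ.+ d) ≡ s k →
                        s (k ℤ.+ ℤ.+ 1) ≡ s (k ℤ.- ℤ.+ d) → ⊥
  centre-not-repeated zero    _  e₂ = c≢c′ (sym (trans e₂ (cong s (ℤₚ.+-identityʳ k))))
  centre-not-repeated (suc d) e₁ e₂ = c≢c′ (begin
    s k                               ≡⟨ e₁ ⟨
    s (k ℤ.+ ℤ.+ 1 ℤ.+ ℤ.+ suc d)     ≡⟨ cong s (shift k (ℤ.+ d)) ⟩
    s (k ℤ.+ ℤ.+ (2 + d))             ≡⟨ right d ⟩
    p d                               ≡⟨ left d ⟨
    s (k ℤ.- ℤ.+ suc d)               ≡⟨ e₂ ⟨
    s (k ℤ.+ ℤ.+ 1)                   ∎)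
    where
      open ≡-Reasoning
      shift : ∀ k x → k ℤ.+ ℤ.+ 1 ℤ.+ (ℤ.+ 1 ℤ.+ x) ≡ k ℤ.+ (ℤ.+ 2 ℤ.+ x)
      shift = solve-∀

  FactorUpToReversalOfLength : ℕ → List Bool → Set
  FactorUpToReversalOfLength n v = length v ≡ n × FactorUpToReversal s v

  -- Once 1·p[0..n) is removed, dropping the first letter is injective: 0v and 1v force v = p[0..n).
  complexity≤1+n : ∀ n {xs} → Unique xs → All (FactorUpToReversalOfLength n) xs → length xs ≤ suc n
  complexity≤1+n zero {[]}              _                  _ = z≤n
  complexity≤1+n zero {_ ∷ []}          _                  _ = s≤s z≤n
  complexity≤1+n zero {[] ∷ [] ∷ _}     ((x≢y ∷ _) ∷ _)    _ = ⊥-elim (x≢y refl)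
  complexity≤1+n zero {(_ ∷ _) ∷ _}     _ ((() , _) ∷ _)
  complexity≤1+n zero {[] ∷ (_ ∷ _) ∷ _} _ (_ ∷ (() , _) ∷ _)
  complexity≤1+n (suc n) {xs} xs! words = ℕₚ.≤-trans (length≤1+length-filter-≢ _≟ᵂ_ e xs!)
    (s≤s (subst (_≤ suc n) (Listₚ.length-map (drop 1) ys)
      (complexity≤1+n n (Unique-map⁺-injectiveOn drop1-injective ys-kept (Uniqueₚ.filter⁺ _ xs!))
                    (Allₚ.map⁺ (All.map (drop1-word ∘ proj₁) ys-kept)))))
    where
      e : List Bool
      e = true ∷ pref p n
      ys : List (List Bool)
      ys = filter (λ x → ¬? (x ≟ᵂ e)) xs
      Kept : List Bool → Set
      Kept x = FactorUpToReversalOfLength (suc n) x × x ≢ e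
      ys-kept : All Kept ys
      ys-kept = All.zip (Allₚ.filter⁺ _ words , Allₚ.all-filter _ xs)
      drop1-word : ∀ {x} → FactorUpToReversalOfLength (suc n) x → FactorUpToReversalOfLength n (drop 1 x)
      drop1-word {a ∷ x} (l , f) = ℕₚ.suc-injective l , proj₂ (FactorUpToReversal-++ (a ∷ []) x f)
      tail≡pref : ∀ {v} → length v ≡ n →
                  FactorUpToReversal s (false ∷ v) → FactorUpToReversal s (true ∷ v) → v ≡ pref p n
      tail≡pref l f₀ f₁ = trans (left-special⇒pref f₀ f₁) (cong (pref p) l)
      drop1-injective : ∀ {x y} → Kept x → Kept y → drop 1 x ≡ drop 1 y → x ≡ y
      drop1-injective {false ∷ v} {false ∷ .v} _ _ refl = refl
      drop1-injective {true ∷ v}  {true ∷ .v}  _ _ refl = refl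
      drop1-injective {false ∷ v} {true ∷ .v} ((l , f₀) , _) ((_ , f₁) , v≢e) refl =
        ⊥-elim (v≢e (cong (true ∷_) (tail≡pref (ℕₚ.suc-injective l) f₀ f₁)))
      drop1-injective {true ∷ v}  {false ∷ .v} ((l , f₁) , v≢e) ((_ , f₀) , _) refl =
        ⊥-elim (v≢e (cong (true ∷_) (tail≡pref (ℕₚ.suc-injective l) f₀ f₁)))

  origin : ℕ → ℤ
  origin j = k ℤ.+ ℤ.+ 1 ℤ.- ℤ.+ j

  -- For 0 ≤ j ≤ n these are the n + 1 windows of length n that meet position k or k + 1.
  window-at : ℕ → ℕ → List Bool
  window-at n j = window s (origin j) n

  windows : ℕ → List (List Bool)
  windows n = applyUpTo (window-at n) (suc n)

  windows-distinct : ∀ {n i j} → i < j → j ≤ n → window-at n i ≢ window-at n j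
  windows-distinct {n} {i} i<j j≤n eq with ℕₚ.m≤n⇒∃[o]m+o≡n i<j
  ... | d , refl = centre-not-repeated d
    (trans (cong s (sym (pos₁ k (ℤ.+ i) (ℤ.+ d))))
      (trans (at {i + d} (ℕₚ.<-≤-trans (ℕₚ.n<1+n _) j≤n)) (cong s (pos₂ k (ℤ.+ i) (ℤ.+ d)))))
    (trans (cong s (sym (pos₃ k (ℤ.+ i))))
      (trans (at {i} (ℕₚ.<-≤-trans (ℕₚ.m≤m+n (suc i) d) j≤n)) (cong s (pos₄ k (ℤ.+ i) (ℤ.+ d)))))
    where
      at : ∀ {t} → t < n → s (origin i ℤ.+ ℤ.+ t) ≡ s (origin (suc (i + d)) ℤ.+ ℤ.+ t)
      at = window-≡-at s eq
      pos₁ : ∀ k x y → (k ℤ.+ ℤ.+ 1 ℤ.- x) ℤ.+ (x ℤ.+ y) ≡ k ℤ.+ ℤ.+ 1 ℤ.+ y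
      pos₁ = solve-∀
      pos₂ : ∀ k x y → (k ℤ.+ ℤ.+ 1 ℤ.- (ℤ.+ 1 ℤ.+ (x ℤ.+ y))) ℤ.+ (x ℤ.+ y) ≡ k
      pos₂ = solve-∀
      pos₃ : ∀ k x → (k ℤ.+ ℤ.+ 1 ℤ.- x) ℤ.+ x ≡ k ℤ.+ ℤ.+ 1
      pos₃ = solve-∀
      pos₄ : ∀ k x y → (k ℤ.+ ℤ.+ 1 ℤ.- (ℤ.+ 1 ℤ.+ (x ℤ.+ y))) ℤ.+ x ≡ k ℤ.- y
      pos₄ = solve-∀

  windows-Unique : ∀ n → Unique (windows n)
  windows-Unique n =
    AllPairsₚ.applyUpTo⁺₁ (window-at n) (suc n) (λ i<j j<1+n → windows-distinct i<j (ℕₚ.≤-pred j<1+n))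

  windows-factors : ∀ n → All (λ v → length v ≡ n × IsFactor s v) (windows n)
  windows-factors n = Allₚ.applyUpTo⁺₂ (window-at n) (suc n)
                        (λ j → length-window s (origin j) n , window-IsFactor s (origin j) n)

  windows-complete : ∀ {n v} → length v ≡ n → FactorUpToReversal s v → v ∈ windows n
  windows-complete {n} {v} l f with v ∈? windows n
  ... | yes v∈ = v∈
  ... | no  v∉ = ⊥-elim (ℕₚ.n≮n (suc n)
          (subst (_≤ suc n) (cong suc (Listₚ.length-applyUpTo (window-at n) (suc n)))
            (complexity≤1+n n (Allₚ.¬Any⇒All¬ _ v∉ ∷ windows-Unique n)
                              ((l , f) ∷ All.map (Product.map₂ inj₁) (windows-factors n)))))

  FactorUpToReversal⇒IsFactor : ∀ {v} → FactorUpToReversal s v → IsFactor s v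
  FactorUpToReversal⇒IsFactor f = proj₂ (All.lookup (windows-factors _) (windows-complete refl f))

  IsFactor-∷pref : ∀ m b → IsFactor s (b ∷ pref p m)
  IsFactor-∷pref m b = FactorUpToReversal⇒IsFactor (∷pref-FactorUpToReversal m b)

  IsFactor-reverse-pref-∷ʳ : ∀ m b → IsFactor s (reverse (pref p m) ++ b ∷ [])
  IsFactor-reverse-pref-∷ʳ m b = FactorUpToReversal⇒IsFactor
    (inj₂ (subst (IsFactor s) (sym (reverse-reverse-∷ʳ b (pref p m))) (IsFactor-∷pref m b)))

  IsFactor-centre-either : ∀ a b d → IsFactor s (reverse (pref p a) ++ d ∷ not d ∷ pref p b)
  IsFactor-centre-either a b d with d Bool.≟ s k
  ... | yes refl =
    subst (λ e → IsFactor s (reverse (pref p a) ++ d ∷ e ∷ pref p b)) c′≡¬c (IsFactor-centre a b)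
  ... | no d≢c rewrite Boolₚ.¬-not d≢c | Boolₚ.not-involutive (s k) =
    subst (λ e → IsFactor s (reverse (pref p a) ++ e ∷ s k ∷ pref p b)) c′≡¬c
      (FactorUpToReversal⇒IsFactor (inj₂ (subst (IsFactor s)
        (sym (reverse-centre (pref p a) (pref p b) _ _)) (IsFactor-centre b a))))

  right-special⇒reversed-pref : ∀ {z} → IsFactor s (z ++ false ∷ []) → IsFactor s (z ++ true ∷ []) →
                                z ≡ reverse (pref p (length z))
  right-special⇒reversed-pref {z} f₀ f₁ = begin
    z                                        ≡⟨ Listₚ.reverse-involutive z ⟨
    reverse (reverse z)                      ≡⟨ cong reverse (left-special⇒pref (mirror f₀) (mirror f₁)) ⟩
    reverse (pref p (length (reverse z)))    ≡⟨ cong (reverse ∘ pref p) (Listₚ.length-reverse z) ⟩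
    reverse (pref p (length z))              ∎
    where
      open ≡-Reasoning
      mirror : ∀ {b} → IsFactor s (z ++ b ∷ []) → FactorUpToReversal s (b ∷ reverse z)
      mirror {b} f = inj₂ (subst (IsFactor s) (sym (reverse-∷-reverse b z)) f)

  right-special-letter : ∀ z a q {r r′} → IsFactor s (z ++ a ∷ q ++ false ∷ r) →
                         IsFactor s (z ++ a ∷ q ++ true ∷ r′) → p (length q) ≡ a
  right-special-letter z a q f₀ f₁ = begin
    p (length q)            ≡⟨ cong p (Listₚ.length-reverse q) ⟨
    p (length (reverse q))  ≡⟨ pref-lookup p _ (reverse q) reversed ⟩
    a                       ∎
    where
      open ≡-Reasoning
      Z : List Bool
      Z = z ++ a ∷ q
      prefix : ∀ {b r} → IsFactor s (z ++ a ∷ q ++ b ∷ r) → IsFactor s (Z ++ b ∷ [])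
      prefix {b} {r} f =
        IsFactor-prefix-∷ʳ s Z b (subst (IsFactor s) (sym (Listₚ.++-assoc z (a ∷ q) (b ∷ r))) f)
      reversed : pref p (length Z) ≡ reverse q ++ a ∷ reverse z
      reversed = begin
        pref p (length Z)             ≡⟨ Listₚ.reverse-involutive _ ⟨
        reverse (reverse (pref p (length Z)))
          ≡⟨ cong reverse (right-special⇒reversed-pref (prefix f₀) (prefix f₁)) ⟨
        reverse Z                      ≡⟨ Listₚ.reverse-++ z (a ∷ q) ⟩
        reverse (a ∷ q) ++ reverse z   ≡⟨ cong (_++ reverse z) (Listₚ.unfold-reverse a q) ⟩
        (reverse q ++ a ∷ []) ++ reverse z ≡⟨ Listₚ.++-assoc (reverse q) (a ∷ []) (reverse z) ⟩
        reverse q ++ a ∷ reverse z     ∎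

  sorted-factors : ∀ n → Σ (Fin (suc n) → List Bool) λ u →
    (∀ a → length (u a) ≡ n) × (∀ a → IsFactor s (u a)) ×
    (∀ (j : Fin n) → u (inject₁ j) <lex u (F.suc j)) ×
    (∀ v → length v ≡ n → IsFactor s v → ∃ λ a → u a ≡ v)
  sorted-factors n = u , proj₁ ∘ u-factor , proj₂ ∘ u-factor , lookup-Linked S-increasing |S| , complete
    where
      S : List (List Bool)
      S = sort (windows n)
      S↭ : windows n ↭ S
      S↭ = ↭-sym (sort-↭ (windows n))
      |S| : suc n ≡ length S
      |S| = trans (sym (Listₚ.length-applyUpTo (window-at n) (suc n))) (↭-length S↭)
      u : Fin (suc n) → List Bool
      u a = lookup S (cast |S| a)
      S-factors : All (λ v → length v ≡ n × IsFactor s v) S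
      S-factors = All-resp-↭ S↭ (windows-factors n)
      u-factor : ∀ a → length (u a) ≡ n × IsFactor s (u a)
      u-factor a = All.lookup S-factors (∈-lookup (cast |S| a))
      S-increasing : Linked _<lex_ S
      S-increasing = Linked-Lex-≤⇒Linked-<lex (sort-↗ (windows n))
        (Permₛ.Unique-resp-↭ (setoid _) (↭⇒↭ₛ S↭) (windows-Unique n)) (All.map proj₁ S-factors)
      complete : ∀ v → length v ≡ n → IsFactor s v → ∃ λ a → u a ≡ v
      complete v l f = cast (sym |S|) (index v∈S) ,
        trans (cong (lookup S) (Finₚ.cast-involutive |S| (sym |S|) (index v∈S))) (sym (Anyₚ.lookup-index v∈S))
        where
          v∈S : v ∈ S
          v∈S = ∈-resp-↭ S↭ (windows-complete l (inj₁ f))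

  0∷pref-minimal : ∀ {v} m → IsFactor s v → ¬ v <lex (false ∷ pref p m)
  0∷pref-minimal m f (there v<w) = 0x∧1y⇒x≮y bal (inj₁ f) (inj₁ (IsFactor-∷pref m true)) v<w

  1∷pref-maximal : ∀ {v} m → IsFactor s v → ¬ (true ∷ pref p m) <lex v
  1∷pref-maximal m f (there w<v) = 0x∧1y⇒x≮y bal (inj₁ (IsFactor-∷pref m false)) (inj₁ f) w<v

  ¬centre-fork : ∀ z d q {b r r₀ r₁} → pref p b ≡ q ++ d ∷ r →
                 IsFactor s (z ++ d ∷ not d ∷ q ++ false ∷ r₀) →
                 IsFactor s (z ++ d ∷ not d ∷ q ++ true ∷ r₁) → ⊥
  ¬centre-fork z d q {b} P≡ f₀ f₁ = Boolₚ.not-¬ refl (trans (sym (pref-lookup p b q P≡))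
    (right-special-letter (z ++ d ∷ []) (not d) q (reassoc f₀) (reassoc f₁)))
    where
      reassoc : ∀ {x} → IsFactor s (z ++ d ∷ x) → IsFactor s ((z ++ d ∷ []) ++ x)
      reassoc {x} = subst (IsFactor s) (sym (Listₚ.++-assoc z (d ∷ []) x))

  module SortedFactors {n} (1≤n : 1 ≤ n) (u : Fin (suc n) → List Bool)
    (u-length : ∀ a → length (u a) ≡ n) (u-factor : ∀ a → IsFactor s (u a))
    (u-increasing : ∀ (j : Fin n) → u (inject₁ j) <lex u (F.suc j))
    (u-complete : ∀ v → length v ≡ n → IsFactor s v → ∃ λ a → u a ≡ v) where

    open Enumeration (IsFactor s) u u-length u-increasing u-complete

    w : List Bool
    w = pref p (n ∸ 1)

    length-∷w : ∀ b → length (b ∷ w) ≡ n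
    length-∷w b = trans (cong suc (length-pref p (n ∸ 1))) (ℕₚ.m+[n∸m]≡n 1≤n)

    length-w̃∷ʳ : ∀ b → length (reverse w ++ b ∷ []) ≡ n
    length-w̃∷ʳ b = trans (cong length (sym (Listₚ.reverse-++ (b ∷ []) w)))
                         (trans (Listₚ.length-reverse (b ∷ w)) (length-∷w b))

    extremes : u F.zero ≡ false ∷ w × u (fromℕ n) ≡ true ∷ w
    extremes = first (length-∷w false) (IsFactor-∷pref _ false) (λ a → 0∷pref-minimal _ (u-factor a))
             , last (length-∷w true) (IsFactor-∷pref _ true) (λ a → 1∷pref-maximal _ (u-factor a))

    centre : Σ (Fin n) λ i →
             u (inject₁ i) ≡ reverse w ++ false ∷ [] × u (F.suc i) ≡ reverse w ++ true ∷ []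
    centre = successor (length-w̃∷ʳ false) (IsFactor-reverse-pref-∷ʳ (n ∸ 1) false)
                       (length-w̃∷ʳ true) (IsFactor-reverse-pref-∷ʳ (n ∸ 1) true)
                       (<lex-++⁺ˡ (reverse w) here) (<lex-no-word-between (reverse w))

    IsFactor-≡u : ∀ {a x} → u a ≡ x → IsFactor s x
    IsFactor-≡u {a} e = subst (IsFactor s) e (u-factor a)

    length-≡u : ∀ {a x} → u a ≡ x → length x ≡ n
    length-≡u {a} e = trans (cong length (sym e)) (u-length a)

    common-prefix≡reversed-pref : ∀ j {z α β} → u (inject₁ j) ≡ z ++ false ∷ α →
                                  u (F.suc j) ≡ z ++ true ∷ β → z ≡ reverse (pref p (length z))
    common-prefix≡reversed-pref j {z} lo hi = right-special⇒reversed-pref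
      (IsFactor-prefix-∷ʳ s z false (IsFactor-≡u lo)) (IsFactor-prefix-∷ʳ s z true (IsFactor-≡u hi))

    lower-tail : ∀ j z {a α β} → z ≡ reverse (pref p (length z)) →
                 u (inject₁ j) ≡ z ++ false ∷ a ∷ α → u (F.suc j) ≡ z ++ true ∷ β →
                 a ∷ α ≡ true ∷ pref p (length α)
    lower-tail j z {a} {α} z≡ lo hi =
      resolve (<lex-compare (a ∷ α) (true ∷ P) (cong suc (sym (length-pref p _))))
      where
        P = pref p (length α)
        X = z ++ false ∷ true ∷ P
        X-factor : IsFactor s X
        X-factor = subst (λ z′ → IsFactor s (z′ ++ false ∷ true ∷ P)) (sym z≡)
                         (IsFactor-centre-either (length z) (length α) false)
        resolve : a ∷ α ≡ true ∷ P ⊎ (a ∷ α) <lex (true ∷ P) ⊎ (true ∷ P) <lex (a ∷ α) →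
                  a ∷ α ≡ true ∷ P
        resolve (inj₁ e) = e
        resolve (inj₂ (inj₁ h)) = ⊥-elim (no-word-between j X
          (trans (length-++-cong z (cong (suc ∘ suc) (length-pref p _))) (length-≡u lo)) X-factor
          (subst (_<lex X) (sym lo) (<lex-++⁺ˡ z (there h))) (subst (X <lex_) (sym hi) (<lex-fork z)))
        resolve (inj₂ (inj₂ (there h))) with <lex-split h
        ... | q , r , r′ , P≡ , refl = ⊥-elim (¬centre-fork z false q P≡
          (subst (λ t → IsFactor s (z ++ false ∷ true ∷ t)) P≡ X-factor) (IsFactor-≡u lo))

    upper-tail : ∀ j z {α b β} → z ≡ reverse (pref p (length z)) →
                 u (inject₁ j) ≡ z ++ false ∷ α → u (F.suc j) ≡ z ++ true ∷ b ∷ β →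
                 b ∷ β ≡ false ∷ pref p (length β)
    upper-tail j z {α} {b} {β} z≡ lo hi =
      resolve (<lex-compare (b ∷ β) (false ∷ P) (cong suc (sym (length-pref p _))))
      where
        P = pref p (length β)
        Y = z ++ true ∷ false ∷ P
        Y-factor : IsFactor s Y
        Y-factor = subst (λ z′ → IsFactor s (z′ ++ true ∷ false ∷ P)) (sym z≡)
                         (IsFactor-centre-either (length z) (length β) true)
        resolve : b ∷ β ≡ false ∷ P ⊎ (b ∷ β) <lex (false ∷ P) ⊎ (false ∷ P) <lex (b ∷ β) →
                  b ∷ β ≡ false ∷ P
        resolve (inj₁ e) = e
        resolve (inj₂ (inj₂ h)) = ⊥-elim (no-word-between j Y
          (trans (length-++-cong z (cong (suc ∘ suc) (length-pref p _))) (length-≡u hi)) Y-factor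
          (subst (_<lex Y) (sym lo) (<lex-fork z)) (subst (Y <lex_) (sym hi) (<lex-++⁺ˡ z (there h))))
        resolve (inj₂ (inj₁ (there h))) with <lex-split h
        ... | q , r′ , r , refl , P≡ = ⊥-elim (¬centre-fork z true q P≡
          (IsFactor-≡u hi) (subst (λ t → IsFactor s (z ++ true ∷ false ∷ t)) P≡ Y-factor))

    off-centre : ∀ j → j ≢ proj₁ centre → ∃ λ a → ∃ λ b →
                 u (inject₁ j) ≡ reverse (take a w) ++ false ∷ true ∷ take b w ×
                 u (F.suc j)   ≡ reverse (take a w) ++ true ∷ false ∷ take b w
    off-centre j j≢i with <lex-split (u-increasing j)
    ... | z , α , β , lo , hi = shape α β lo hi
          (ℕₚ.suc-injective (ℕₚ.+-cancelˡ-≡ (length z) _ _ (trans (|z|+ lo) (sym (|z|+ hi)))))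
      where
        z≡ : z ≡ reverse (pref p (length z))
        z≡ = common-prefix≡reversed-pref j lo hi
        |z|+ : ∀ {a b x} → u a ≡ z ++ b ∷ x → length z + suc (length x) ≡ n
        |z|+ e = trans (sym (Listₚ.length-++ z)) (length-≡u e)
        shape : ∀ α β → u (inject₁ j) ≡ z ++ false ∷ α → u (F.suc j) ≡ z ++ true ∷ β →
                length α ≡ length β → ∃ λ a → ∃ λ b →
                u (inject₁ j) ≡ reverse (take a w) ++ false ∷ true ∷ take b w ×
                u (F.suc j)   ≡ reverse (take a w) ++ true ∷ false ∷ take b w
        shape [] [] lo _ _ = ⊥-elim (j≢i (Finₚ.inject₁-injective (injective
          (trans lo (trans (cong (_++ false ∷ []) (trans z≡ (cong (reverse ∘ pref p) |z|≡n-1)))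
                           (sym (proj₁ (proj₂ centre))))))))
          where
            |z|≡n-1 : length z ≡ n ∸ 1
            |z|≡n-1 = trans (sym (ℕₚ.m+n∸n≡m (length z) 1)) (cong (_∸ 1) (|z|+ lo))
        shape (a ∷ α) (b ∷ β) lo hi |α|≡|β| = length z , length α ,
          trans lo (trans (cong (λ t → z ++ false ∷ t) (lower-tail j z z≡ lo hi)) (frame false true)) ,
          trans hi (trans (cong (λ t → z ++ true ∷ t) (trans (upper-tail j z z≡ lo hi)
            (cong (λ m → false ∷ pref p m) (ℕₚ.suc-injective (sym |α|≡|β|))))) (frame true false))
          where
            n-1≡ : n ∸ 1 ≡ length z + suc (length α)
            n-1≡ = cong (_∸ 1) (trans (sym (|z|+ lo)) (ℕₚ.+-suc (length z) (suc (length α))))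
            frame : ∀ d e → z ++ d ∷ e ∷ pref p (length α) ≡
                            reverse (take (length z) w) ++ d ∷ e ∷ take (length α) w
            frame d e = cong₂ (λ x y → x ++ d ∷ e ∷ y)
              (trans z≡ (cong reverse (sym (take-pref p (subst (length z ≤_) (sym n-1≡) (ℕₚ.m≤m+n _ _))))))
              (sym (take-pref p (subst (length α ≤_) (sym n-1≡) (ℕₚ.≤-trans (ℕₚ.n≤1+n _) (ℕₚ.m≤n+m _ _)))))

lemma4p1 : (s : ℤ → Bool) → Balanced s → (k : ℤ) → (p : ℕ → Bool) → Factorization s k p →
    (n : ℕ) → 1 ≤ n →
    (Σ (Fin (suc n) → List Bool) λ u →
        (∀ a → length (u a) ≡ n) × (∀ a → IsFactor s (u a)) ×
        (∀ (j : Fin n) → u (inject₁ j) <lex u (F.suc j)) ×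
        (∀ v → length v ≡ n → IsFactor s v → ∃ λ a → u a ≡ v))
    ×
    (∀ (u : Fin (suc n) → List Bool) →
        (∀ a → length (u a) ≡ n) → (∀ a → IsFactor s (u a)) →
        (∀ (j : Fin n) → u (inject₁ j) <lex u (F.suc j)) →
        (∀ v → length v ≡ n → IsFactor s v → ∃ λ a → u a ≡ v) →
        let w = pref p (n ∸ 1) in
        (u F.zero ≡ false ∷ w × u (fromℕ n) ≡ true ∷ w)
        × (Σ (Fin n) λ i →
             (u (inject₁ i) ≡ reverse w ++ false ∷ [] × u (F.suc i) ≡ reverse w ++ true ∷ [])
             × (∀ (j : Fin n) → j ≢ i → ∃ λ a → ∃ λ b →
                  u (inject₁ j) ≡ reverse (take a w) ++ false ∷ true ∷ take b w
                  × u (F.suc j) ≡ reverse (take a w) ++ true ∷ false ∷ take b w)))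
lemma4p1 s bal k p fac n 1≤n = sorted-factors n , λ u u-length u-factor u-increasing u-complete →
  let open SortedFactors 1≤n u u-length u-factor u-increasing u-complete in
  extremes , proj₁ centre , proj₂ centre , off-centre
  where open WithFactorization bal fac
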